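{- Full $\rho$-bisimulations are closed under composition: if $(B,\pi_1,\pi_2)$ is a full $\rho$-bisimulation between $T$-coalgebras $(X_1,\gamma_1)$ and $(X_2,\gamma_2)$, and $(B',\pi_2',\pi_3)$ is a full $\rho$-bisimulation between $(X_2,\gamma_2)$ and $(X_3,\gamma_3)$, then their composition $B\circ B'$ is a full $\rho$-bisimulation between $(X_1,\gamma_1)$ and $(X_3,\gamma_3)$.
   Context: $P\colon\mathcal C\to\mathcal A$, $S\colon\mathcal A\to\mathcal C$ are contravariant functors forming a dual adjunction (a bijection $\mathcal C(X,SA)\cong\mathcal A(A,PX)$ natural in $X,A$). $T\colon\mathcal C\to\mathcal C$ is an endofunctor; a $T$-coalgebra is $(X,\gamma)$ with $\gamma\colon X\to TX$. $(L,\rho)$ is a logic: $L\colon\mathcal A\to\mathcal A$ and $\rho\colon LP\to PT$ natural; the complex algebra of $(X,\gamma)$ is $\gamma^*=P\gamma\circ\rho_X$. Standing assumptions: $\mathcal C$ is finitely complete, well-powered, and has an $(\mathcal E,\mathrm{Mono})$-factorisation system (every morphism factors as $m\circ e$ with $e\in\mathcal E$, $m$ mono, both classes closed under composition, with unique diagonal fill-ins); $\mathcal A$ has pullbacks or $\mathcal C$ has pushouts. A span $X_1\xleftarrow{\pi_1}B\xrightarrow{\pi_2}X_2$ is jointly mono if $\pi_1h=\pi_1h'$ and $\pi_2h=\pi_2h'$ imply $h=h'$. Its dual span $(\bar B,\bar\pi_1,\bar\pi_2)$ is the pullback in $\mathcal A$ of $PX_1\xrightarrow{P\pi_1}PB\xleftarrow{P\pi_2}PX_2$.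 A jointly mono span is a $\rho$-bisimulation between $(X_1,\gamma_1)$ and $(X_2,\gamma_2)$ if $P\pi_1\circ\gamma_1^*\circ L\bar\pi_1=P\pi_2\circ\gamma_2^*\circ L\bar\pi_2$; it is full if both $\pi_1$ and $\pi_2$ are split epimorphisms. The composition of jointly mono spans $(B,\pi_1,\pi_2)$ from $X_1$ to $X_2$ and $(B',\pi_2',\pi_3)$ from $X_2$ to $X_3$ is defined as follows: let $(C,c_1,c_3)$ be the pullback of $\pi_2$ and $\pi_2'$, and let $B\circ B'$ (with its two projections to $X_1$ and $X_3$) be given by the $(\mathcal E,\mathrm{Mono})$-factorisation $C\twoheadrightarrow B\circ B'\hookrightarrow X_1\times X_3$ of $\langle\pi_1 c_1,\pi_3 c_3\rangle$. -}

module Defs where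

open import Level using (Level; _⊔_) renaming (suc to lsuc)
open import Data.Product using (Σ; Σ-syntax; _×_; _,_; proj₁; proj₂)
open import Data.Sum using (_⊎_)
open import Relation.Binary.PropositionalEquality using (_≡_)

record Category (o h : Level) : Set (lsuc (o ⊔ h)) where
  infixr 9 _∘_
  field
    Obj : Set o
    _⇒_ : Obj → Obj → Set h
    id  : ∀ {X} → X ⇒ X
    _∘_ : ∀ {X Y Z} → Y ⇒ Z → X ⇒ Y → X ⇒ Z
    identityˡ : ∀ {X Y} {f : X ⇒ Y} → id ∘ f ≡ f
    identityʳ : ∀ {X Y} {f : X ⇒ Y} → f ∘ id ≡ f
    assoc : ∀ {W X Y Z} {f : W ⇒ X} {g : X ⇒ Y} {k : Y ⇒ Z} →
            (k ∘ g) ∘ f ≡ k ∘ (g ∘ f)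

module _ {o h} (C : Category o h) where
  open Category C

  Mono : ∀ {X Y} → X ⇒ Y → Set (o ⊔ h)
  Mono {X} m = ∀ {W} (u v : W ⇒ X) → m ∘ u ≡ m ∘ v → u ≡ v

  SplitEpi : ∀ {X Y} → X ⇒ Y → Set h
  SplitEpi {X} {Y} e = Σ[ s ∈ Y ⇒ X ] (e ∘ s ≡ id)

  IsIso : ∀ {X Y} → X ⇒ Y → Set h
  IsIso {X} {Y} f = Σ[ g ∈ Y ⇒ X ] ((g ∘ f ≡ id) × (f ∘ g ≡ id))

  ∃!⇒ : ∀ {X Y} → (X ⇒ Y → Set h) → Set h
  ∃!⇒ {X} {Y} Q = Σ[ u ∈ X ⇒ Y ] (Q u × (∀ u' → Q u' → u' ≡ u))

  record Pullback {X Y Z} (f : X ⇒ Z) (g : Y ⇒ Z) : Set (o ⊔ h) where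
    field
      P   : Obj
      p₁  : P ⇒ X
      p₂  : P ⇒ Y
      commute : f ∘ p₁ ≡ g ∘ p₂
      universal : ∀ {Q} (q₁ : Q ⇒ X) (q₂ : Q ⇒ Y) → f ∘ q₁ ≡ g ∘ q₂ →
                  ∃!⇒ (λ u → (p₁ ∘ u ≡ q₁) × (p₂ ∘ u ≡ q₂))

  record Pushout {X Y Z} (f : Z ⇒ X) (g : Z ⇒ Y) : Set (o ⊔ h) where
    field
      Q   : Obj
      i₁  : X ⇒ Q
      i₂  : Y ⇒ Q
      commute : i₁ ∘ f ≡ i₂ ∘ g
      universal : ∀ {R} (r₁ : X ⇒ R) (r₂ : Y ⇒ R) → r₁ ∘ f ≡ r₂ ∘ g →
                  ∃!⇒ (λ u → (u ∘ i₁ ≡ r₁) × (u ∘ i₂ ≡ r₂))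

  record Product (X Y : Obj) : Set (o ⊔ h) where
    field
      X×Y  : Obj
      fst  : X×Y ⇒ X
      snd  : X×Y ⇒ Y
      universal : ∀ {Q} (q₁ : Q ⇒ X) (q₂ : Q ⇒ Y) →
                  ∃!⇒ (λ u → (fst ∘ u ≡ q₁) × (snd ∘ u ≡ q₂))
    ⟨_,_⟩ : ∀ {Q} → Q ⇒ X → Q ⇒ Y → Q ⇒ X×Y
    ⟨ q₁ , q₂ ⟩ = proj₁ (universal q₁ q₂)

  record Terminal : Set (o ⊔ h) where
    field
      ⊤ : Obj
      ! : ∀ {X} → X ⇒ ⊤
      !-unique : ∀ {X} (f : X ⇒ ⊤) → f ≡ !

  record FinitelyComplete : Set (o ⊔ h) where
    field
      terminal : Terminal
      product  : ∀ X Y → Product X Y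
      pullback : ∀ {X Y Z} (f : X ⇒ Z) (g : Y ⇒ Z) → Pullback f g

  HasPullbacks : Set (o ⊔ h)
  HasPullbacks = ∀ {X Y Z} (f : X ⇒ Z) (g : Y ⇒ Z) → Pullback f g

  HasPushouts : Set (o ⊔ h)
  HasPushouts = ∀ {X Y Z} (f : Z ⇒ X) (g : Z ⇒ Y) → Pushout f g

  SameSubobject : ∀ {A A' X} → A ⇒ X → A' ⇒ X → Set h
  SameSubobject {A} {A'} m m' = Σ[ i ∈ A ⇒ A' ] (IsIso i × (m' ∘ i ≡ m))

  WellPowered : Set (lsuc h ⊔ o)
  WellPowered = ∀ X → Σ[ I ∈ Set h ] Σ[ dom ∈ (I → Obj) ]
                Σ[ sub ∈ ((i : I) → dom i ⇒ X) ]
                (((i : I) → Mono (sub i)) ×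
                 (∀ {A} (m : A ⇒ X) → Mono m → Σ[ i ∈ I ] SameSubobject m (sub i)))

  record FactorisationSystem : Set (lsuc h ⊔ o) where
    field
      E : ∀ {X Y} → X ⇒ Y → Set h
      Im  : ∀ {X Y} → X ⇒ Y → Obj
      eOf : ∀ {X Y} (f : X ⇒ Y) → X ⇒ Im f
      mOf : ∀ {X Y} (f : X ⇒ Y) → Im f ⇒ Y
      eOf-E : ∀ {X Y} (f : X ⇒ Y) → E (eOf f)
      mOf-Mono : ∀ {X Y} (f : X ⇒ Y) → Mono (mOf f)
      factorises : ∀ {X Y} (f : X ⇒ Y) → mOf f ∘ eOf f ≡ f
      E-∘ : ∀ {X Y Z} {e : X ⇒ Y} {e' : Y ⇒ Z} → E e → E e' → E (e' ∘ e)
      Mono-∘ : ∀ {X Y Z} {m : X ⇒ Y} {m' : Y ⇒ Z} → Mono m → Mono m' → Mono (m' ∘ m)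
      diagonal : ∀ {A B X Y} {e : A ⇒ B} {m : X ⇒ Y} {u : A ⇒ X} {v : B ⇒ Y} →
                 E e → Mono m → v ∘ e ≡ m ∘ u →
                 ∃!⇒ (λ d → (d ∘ e ≡ u) × (m ∘ d ≡ v))

  record Span (X₁ X₂ : Obj) : Set (o ⊔ h) where
    eta-equality
    constructor span
    field
      B  : Obj
      π₁ : B ⇒ X₁
      π₂ : B ⇒ X₂

  JointlyMono : ∀ {X₁ X₂} → Span X₁ X₂ → Set (o ⊔ h)
  JointlyMono (span B π₁ π₂) = ∀ {W} (u v : W ⇒ B) →
    π₁ ∘ u ≡ π₁ ∘ v → π₂ ∘ u ≡ π₂ ∘ v → u ≡ v

  FullSpan : ∀ {X₁ X₂} → Span X₁ X₂ → Set h
  FullSpan (span B π₁ π₂) = SplitEpi π₁ × SplitEpi π₂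

  composeSpan : FinitelyComplete → FactorisationSystem →
                ∀ {X₁ X₂ X₃} → Span X₁ X₂ → Span X₂ X₃ → Span X₁ X₃
  composeSpan fc fs {X₁} {X₂} {X₃} (span B π₁ π₂) (span B' π₂' π₃) =
      span (FactorisationSystem.Im fs k) (Product.fst prod ∘ m) (Product.snd prod ∘ m)
    where
      pb = FinitelyComplete.pullback fc π₂ π₂'
      prod = FinitelyComplete.product fc X₁ X₃
      k = Product.⟨_,_⟩ prod (π₁ ∘ Pullback.p₁ pb) (π₃ ∘ Pullback.p₂ pb)
      m = FactorisationSystem.mOf fs k

record Functor {o h o' h'} (C : Category o h) (D : Category o' h')
       : Set (o ⊔ h ⊔ o' ⊔ h') where
  private module C = Category C
  private module D = Category D
  field
    F₀ : C.Obj → D.Obj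
    F₁ : ∀ {X Y} → X C.⇒ Y → F₀ X D.⇒ F₀ Y
    F-id : ∀ {X} → F₁ (C.id {X}) ≡ D.id
    F-∘  : ∀ {X Y Z} {f : X C.⇒ Y} {g : Y C.⇒ Z} → F₁ (g C.∘ f) ≡ F₁ g D.∘ F₁ f

record ContraFunctor {o h o' h'} (C : Category o h) (D : Category o' h')
       : Set (o ⊔ h ⊔ o' ⊔ h') where
  private module C = Category C
  private module D = Category D
  field
    F₀ : C.Obj → D.Obj
    F₁ : ∀ {X Y} → X C.⇒ Y → F₀ Y D.⇒ F₀ X
    F-id : ∀ {X} → F₁ (C.id {X}) ≡ D.id
    F-∘  : ∀ {X Y Z} {f : X C.⇒ Y} {g : Y C.⇒ Z} → F₁ (g C.∘ f) ≡ F₁ f D.∘ F₁ g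

record Setting (o h o' h' : Level) : Set (lsuc (o ⊔ h ⊔ o' ⊔ h')) where
  field
    C : Category o h
    𝒜 : Category o' h'
  module C = Category C
  module 𝒜 = Category 𝒜
  field
    P : ContraFunctor C 𝒜
    S : ContraFunctor 𝒜 C
  module P = ContraFunctor P
  module S = ContraFunctor S
  field
    φ  : ∀ {X A} → X C.⇒ S.F₀ A → A 𝒜.⇒ P.F₀ X
    φ⁻ : ∀ {X A} → A 𝒜.⇒ P.F₀ X → X C.⇒ S.F₀ A
    φ⁻-φ : ∀ {X A} (f : X C.⇒ S.F₀ A) → φ⁻ (φ f) ≡ f
    φ-φ⁻ : ∀ {X A} (g : A 𝒜.⇒ P.F₀ X) → φ (φ⁻ g) ≡ g
    φ-natural : ∀ {X X' A A'} (f : X' C.⇒ X) (g : A' 𝒜.⇒ A) (k : X C.⇒ S.F₀ A) →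
                φ (S.F₁ g C.∘ k C.∘ f) ≡ P.F₁ f 𝒜.∘ φ k 𝒜.∘ g
    T : Functor C C
  module T = Functor T
  field
    L : Functor 𝒜 𝒜
  module L = Functor L
  field
    ρ : ∀ X → L.F₀ (P.F₀ X) 𝒜.⇒ P.F₀ (T.F₀ X)
    ρ-natural : ∀ {X Y} (f : X C.⇒ Y) →
                ρ X 𝒜.∘ L.F₁ (P.F₁ f) ≡ P.F₁ (T.F₁ f) 𝒜.∘ ρ Y
    C-finitelyComplete : FinitelyComplete C
    C-wellPowered : WellPowered C
    C-factorisation : FactorisationSystem C
    𝒜-pullbacks-or-C-pushouts : HasPullbacks 𝒜 ⊎ HasPushouts C

  record Coalgebra : Set (o ⊔ h) where
    eta-equality
    constructor coalg
    field
      X : C.Obj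
      γ : X C.⇒ T.F₀ X

  complexAlg : (c : Coalgebra) → L.F₀ (P.F₀ (Coalgebra.X c)) 𝒜.⇒ P.F₀ (Coalgebra.X c)
  complexAlg (coalg X γ) = P.F₁ γ 𝒜.∘ ρ X

  IsRhoBisim : (c₁ c₂ : Coalgebra) → Span C (Coalgebra.X c₁) (Coalgebra.X c₂) →
               Set (o ⊔ h ⊔ o' ⊔ h')
  IsRhoBisim c₁ c₂ s@(span B π₁ π₂) =
    JointlyMono C s ×
    ((dual : Pullback 𝒜 (P.F₁ π₁) (P.F₁ π₂)) →
      P.F₁ π₁ 𝒜.∘ complexAlg c₁ 𝒜.∘ L.F₁ (Pullback.p₁ dual)
        ≡ P.F₁ π₂ 𝒜.∘ complexAlg c₂ 𝒜.∘ L.F₁ (Pullback.p₂ dual))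

  IsFullRhoBisim : (c₁ c₂ : Coalgebra) → Span C (Coalgebra.X c₁) (Coalgebra.X c₂) →
                   Set (o ⊔ h ⊔ o' ⊔ h')
  IsFullRhoBisim c₁ c₂ s = IsRhoBisim c₁ c₂ s × FullSpan C s

  _⊙_ : ∀ {X₁ X₂ X₃} → Span C X₁ X₂ → Span C X₂ X₃ → Span C X₁ X₃
  s ⊙ s' = composeSpan C C-finitelyComplete C-factorisation s s'

-- B ∘ B' is the image of the pullback of π₂ and π₂′ under a map e ∈ E. Maps in
-- E are epi (they split every mono they factor through, e.g. an equaliser) and P
-- turns epis into monos, so the bisimulation equation for B ∘ B' may be checked
-- after precomposing with P e, where it becomes the equation for B followed by
-- the one for B'. To invoke these, a cone (d₁, d₃) over P q₁, P q₃, for q₁, q₃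
-- the legs of B ∘ B', is extended to cones over the dual spans of B and B' by
-- the middle leg d₂ = P(π₁ ∘ t₂) d₁, t₂ a section of π₂; fullness of the middle
-- legs π₂, π₂′ is what makes this possible.
module Submission where

open import Defs
open import Level using (Level; _⊔_)
open import Data.Product using (Σ-syntax; _×_; _,_; proj₁; proj₂)
open import Data.Sum using (inj₁; inj₂)
open import Relation.Binary.PropositionalEquality

module CategoryLemmas {o h} (C : Category o h) where
  open Category C

  Epi : ∀ {X Y} → X ⇒ Y → Set (o ⊔ h)
  Epi {Y = Y} e = ∀ {Z} (f g : Y ⇒ Z) → f ∘ e ≡ g ∘ e → f ≡ g

  pullˡ : ∀ {W X Y Z} {a : Y ⇒ Z} {b : X ⇒ Y} {c : X ⇒ Z} {f : W ⇒ X} →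
          a ∘ b ≡ c → a ∘ (b ∘ f) ≡ c ∘ f
  pullˡ {f = f} eq = trans (sym assoc) (cong (_∘ f) eq)

  pullʳ : ∀ {W X Y Z} {a : X ⇒ Y} {b : W ⇒ X} {c : W ⇒ Y} {f : Y ⇒ Z} →
          a ∘ b ≡ c → (f ∘ a) ∘ b ≡ f ∘ c
  pullʳ {f = f} eq = trans assoc (cong (f ∘_) eq)

  cancelˡ : ∀ {W X Y} {a : X ⇒ Y} {b : Y ⇒ X} {f : W ⇒ Y} →
            a ∘ b ≡ id → a ∘ (b ∘ f) ≡ f
  cancelˡ eq = trans (pullˡ eq) identityˡ

  ∃!-unique : ∀ {X Y} {Q : X ⇒ Y → Set h} → ∃!⇒ C Q → ∀ {a b} → Q a → Q b → a ≡ b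
  ∃!-unique (_ , _ , unique) qa qb = trans (unique _ qa) (sym (unique _ qb))

  module _ {X Y} (pr : Product C X Y) where
    open Product pr

    project₁ : ∀ {Q} {a : Q ⇒ X} {b : Q ⇒ Y} → fst ∘ ⟨ a , b ⟩ ≡ a
    project₁ {a = a} {b} = proj₁ (proj₁ (proj₂ (universal a b)))

    project₂ : ∀ {Q} {a : Q ⇒ X} {b : Q ⇒ Y} → snd ∘ ⟨ a , b ⟩ ≡ b
    project₂ {a = a} {b} = proj₂ (proj₁ (proj₂ (universal a b)))

    product-ext : ∀ {Q} {u v : Q ⇒ X×Y} →
                  fst ∘ u ≡ fst ∘ v → snd ∘ u ≡ snd ∘ v → u ≡ v
    product-ext {v = v} p q = ∃!-unique (universal (fst ∘ v) (snd ∘ v)) (p , q) (refl , refl)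

  module _ {X Y Z} {f : X ⇒ Z} {g : Y ⇒ Z} (pb : Pullback C f g) where
    open Pullback pb

    pullback-factor : ∀ {W} (a : W ⇒ X) (b : W ⇒ Y) → f ∘ a ≡ g ∘ b →
                      Σ[ u ∈ W ⇒ P ] (p₁ ∘ u ≡ a × p₂ ∘ u ≡ b)
    pullback-factor a b eq = let (u , βs , _) = universal a b eq in u , βs

    pullback-ext : ∀ {W} {u v : W ⇒ P} →
                   p₁ ∘ u ≡ p₁ ∘ v → p₂ ∘ u ≡ p₂ ∘ v → u ≡ v
    pullback-ext {v = v} p q = ∃!-unique (universal (p₁ ∘ v) (p₂ ∘ v) cone) (p , q) (refl , refl)
      where
        cone : f ∘ p₁ ∘ v ≡ g ∘ p₂ ∘ v
        cone = trans (sym assoc) (trans (cong (_∘ v) commute) assoc)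

record Equaliser {o h} (C : Category o h) {Y Z} (f g : Category._⇒_ C Y Z)
       : Set (o ⊔ h) where
  open Category C
  field
    Eq        : Obj
    ι         : Eq ⇒ Y
    equalises : f ∘ ι ≡ g ∘ ι
    ι-mono    : Mono C ι
    factor    : ∀ {W} (k : W ⇒ Y) → f ∘ k ≡ g ∘ k → Σ[ u ∈ W ⇒ Eq ] ι ∘ u ≡ k

module FactorisationLemmas {o h} (C : Category o h) (fc : FinitelyComplete C)
                           (fs : FactorisationSystem C) where
  open Category C
  open CategoryLemmas C
  open FinitelyComplete fc
  open FactorisationSystem fs
  open ≡-Reasoning

  equaliser : ∀ {Y Z} (f g : Y ⇒ Z) → Equaliser C f g
  equaliser {Y} {Z} f g = record
    { Eq = P ; ι = p₁ ; equalises = trans f∘p₁ (sym g∘p₁)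
    ; ι-mono = p₁-mono ; factor = factor }
    where
      pr : Product C Z Z
      pr = product Z Z
      open Product pr

      δ : Z ⇒ X×Y
      δ = ⟨ id , id ⟩
      open Pullback (pullback ⟨ f , g ⟩ δ)

      leg : ∀ {a : Y ⇒ Z} (pj : X×Y ⇒ Z) →
            pj ∘ ⟨ f , g ⟩ ≡ a → pj ∘ δ ≡ id → a ∘ p₁ ≡ p₂
      leg {a} pj pj∘⟨f,g⟩ pj∘δ = begin
        a ∘ p₁                 ≡⟨ cong (_∘ p₁) (sym pj∘⟨f,g⟩) ⟩
        (pj ∘ ⟨ f , g ⟩) ∘ p₁  ≡⟨ pullʳ commute ⟩
        pj ∘ (δ ∘ p₂)          ≡⟨ cancelˡ pj∘δ ⟩
        p₂                     ∎

      f∘p₁ : f ∘ p₁ ≡ p₂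
      f∘p₁ = leg fst (project₁ pr) (project₁ pr)

      g∘p₁ : g ∘ p₁ ≡ p₂
      g∘p₁ = leg snd (project₂ pr) (project₂ pr)

      p₁-mono : Mono C p₁
      p₁-mono u v eq = pullback-ext (pullback ⟨ f , g ⟩ δ) eq (begin
        p₂ ∘ u         ≡⟨ cong (_∘ u) (sym f∘p₁) ⟩
        (f ∘ p₁) ∘ u   ≡⟨ pullʳ eq ⟩
        f ∘ (p₁ ∘ v)   ≡⟨ pullˡ f∘p₁ ⟩
        p₂ ∘ v         ∎)

      factor : ∀ {W} (k : W ⇒ Y) → f ∘ k ≡ g ∘ k → Σ[ u ∈ W ⇒ P ] p₁ ∘ u ≡ k
      factor k fk≡gk =
        let (u , p₁u , _) = pullback-factor (pullback ⟨ f , g ⟩ δ) k (f ∘ k) square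
        in u , p₁u
        where
          square : ⟨ f , g ⟩ ∘ k ≡ δ ∘ (f ∘ k)
          square = product-ext pr
            (trans (pullˡ (project₁ pr)) (sym (cancelˡ (project₁ pr))))
            (trans (pullˡ (project₂ pr)) (trans (sym fk≡gk) (sym (cancelˡ (project₂ pr)))))

  E-through-mono⇒SplitEpi : ∀ {A X Y} {e : A ⇒ Y} {m : X ⇒ Y} {u : A ⇒ X} →
                            E e → Mono C m → m ∘ u ≡ e → SplitEpi C m
  E-through-mono⇒SplitEpi Ee m-mono mu≡e =
    let (d , (_ , md≡id) , _) = diagonal Ee m-mono (trans identityˡ (sym mu≡e))
    in d , md≡id

  E⇒Epi : ∀ {X Y} {e : X ⇒ Y} → E e → Epi e
  E⇒Epi {e = e} Ee f g fe≡ge = begin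
    f                        ≡⟨ sym identityʳ ⟩
    f ∘ id                   ≡⟨ cong (f ∘_) (sym (proj₂ ι-split)) ⟩
    f ∘ (ι ∘ proj₁ ι-split)  ≡⟨ pullˡ equalises ⟩
    (g ∘ ι) ∘ proj₁ ι-split  ≡⟨ pullʳ (proj₂ ι-split) ⟩
    g ∘ id                   ≡⟨ identityʳ ⟩
    g                        ∎
    where
      open Equaliser (equaliser f g)

      ι-split : SplitEpi C ι
      ι-split = E-through-mono⇒SplitEpi Ee ι-mono (proj₂ (factor e fe≡ge))

module SettingLemmas {o h o' h'} (𝕊 : Setting o h o' h') where
  open Setting 𝕊
  open C using (_∘_)
  open 𝒜 using () renaming (_∘_ to _·_)
  open CategoryLemmas C using (Epi)
  open CategoryLemmas 𝒜 using (pullback-factor)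
  open ≡-Reasoning

  φ-∘ : ∀ {X X' A} (k : X C.⇒ S.F₀ A) (f : X' C.⇒ X) → φ (k ∘ f) ≡ P.F₁ f · φ k
  φ-∘ k f = begin
    φ (k ∘ f)               ≡⟨ cong φ (sym C.identityˡ) ⟩
    φ (C.id ∘ k ∘ f)        ≡⟨ cong (λ z → φ (z ∘ k ∘ f)) (sym S.F-id) ⟩
    φ (S.F₁ 𝒜.id ∘ k ∘ f)   ≡⟨ φ-natural f 𝒜.id k ⟩
    P.F₁ f · φ k · 𝒜.id     ≡⟨ cong (P.F₁ f ·_) 𝒜.identityʳ ⟩
    P.F₁ f · φ k            ∎

  φ⁻-· : ∀ {X X' A} (g : A 𝒜.⇒ P.F₀ X) (f : X' C.⇒ X) → φ⁻ (P.F₁ f · g) ≡ φ⁻ g ∘ f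
  φ⁻-· g f = begin
    φ⁻ (P.F₁ f · g)          ≡⟨ cong (λ z → φ⁻ (P.F₁ f · z)) (sym (φ-φ⁻ g)) ⟩
    φ⁻ (P.F₁ f · φ (φ⁻ g))   ≡⟨ cong φ⁻ (sym (φ-∘ (φ⁻ g) f)) ⟩
    φ⁻ (φ (φ⁻ g ∘ f))        ≡⟨ φ⁻-φ _ ⟩
    φ⁻ g ∘ f                 ∎

  φ⁻-transpose : ∀ {X X' A} (f : X' C.⇒ X) {u : A 𝒜.⇒ P.F₀ X} {q : A 𝒜.⇒ P.F₀ X'} →
                 P.F₁ f · u ≡ q → φ⁻ u ∘ f ≡ φ⁻ q
  φ⁻-transpose f {u} eq = trans (sym (φ⁻-· u f)) (cong φ⁻ eq)

  φ-transpose : ∀ {X X' A} (f : X' C.⇒ X) {w : X C.⇒ S.F₀ A} {q : A 𝒜.⇒ P.F₀ X'} →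
                w ∘ f ≡ φ⁻ q → P.F₁ f · φ w ≡ q
  φ-transpose f {w} {q} eq = trans (sym (φ-∘ w f)) (trans (cong φ eq) (φ-φ⁻ q))

  φ⁻-injective : ∀ {X A} {a b : A 𝒜.⇒ P.F₀ X} → φ⁻ a ≡ φ⁻ b → a ≡ b
  φ⁻-injective {a = a} {b} eq = trans (sym (φ-φ⁻ a)) (trans (cong φ eq) (φ-φ⁻ b))

  P-Epi⇒Mono : ∀ {X Y} {e : X C.⇒ Y} → Epi e → Mono 𝒜 (P.F₁ e)
  P-Epi⇒Mono {e = e} e-epi u v Pe·u≡Pe·v =
    φ⁻-injective (e-epi (φ⁻ u) (φ⁻ v) (trans (φ⁻-transpose e Pe·u≡Pe·v) (φ⁻-· v e)))

  P-Pushout⇒Pullback : ∀ {X Y Z} {f : Z C.⇒ X} {g : Z C.⇒ Y} →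
                       Pushout C f g → Pullback 𝒜 (P.F₁ f) (P.F₁ g)
  P-Pushout⇒Pullback {X} {Y} {f = f} {g} po = record
    { P = P.F₀ Q ; p₁ = P.F₁ i₁ ; p₂ = P.F₁ i₂
    ; commute = trans (sym P.F-∘) (trans (cong P.F₁ commute) P.F-∘)
    ; universal = universal′ }
    where
      open Pushout po

      universal′ : ∀ {W} (q₁ : W 𝒜.⇒ P.F₀ X) (q₂ : W 𝒜.⇒ P.F₀ Y) →
                   P.F₁ f · q₁ ≡ P.F₁ g · q₂ →
                   ∃!⇒ 𝒜 (λ u → (P.F₁ i₁ · u ≡ q₁) × (P.F₁ i₂ · u ≡ q₂))
      universal′ q₁ q₂ eq
        with (w , (wi₁ , wi₂) , w-unique) ←
               universal (φ⁻ q₁) (φ⁻ q₂) (trans (φ⁻-transpose f eq) (φ⁻-· q₂ g)) =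
          φ w
        , (φ-transpose i₁ wi₁ , φ-transpose i₂ wi₂)
        , λ u (ui₁ , ui₂) → trans (sym (φ-φ⁻ u))
            (cong φ (w-unique (φ⁻ u) (φ⁻-transpose i₁ ui₁ , φ⁻-transpose i₂ ui₂)))

  dualPullback : ∀ {X Y Z} (f : Z C.⇒ X) (g : Z C.⇒ Y) → Pullback 𝒜 (P.F₁ f) (P.F₁ g)
  dualPullback f g with 𝒜-pullbacks-or-C-pushouts
  ... | inj₁ 𝒜-pullbacks = 𝒜-pullbacks (P.F₁ f) (P.F₁ g)
  ... | inj₂ C-pushouts  = P-Pushout⇒Pullback (C-pushouts f g)

  P-∘-· : ∀ {X Y Z W} (f : X C.⇒ Y) (g : Y C.⇒ Z) (z : W 𝒜.⇒ P.F₀ Z) →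
          P.F₁ (g ∘ f) · z ≡ P.F₁ f · P.F₁ g · z
  P-∘-· f g z = trans (cong (_· z) P.F-∘) 𝒜.assoc

  P-square : ∀ {X Y Y' Z W} {f : X C.⇒ Y} {g : Y C.⇒ Z} {f' : X C.⇒ Y'} {g' : Y' C.⇒ Z} →
             g ∘ f ≡ g' ∘ f' → (z : W 𝒜.⇒ P.F₀ Z) →
             P.F₁ f · P.F₁ g · z ≡ P.F₁ f' · P.F₁ g' · z
  P-square {f = f} {g} {f'} {g'} gf≡g'f' z = begin
    P.F₁ f · P.F₁ g · z       ≡⟨ sym (P-∘-· f g z) ⟩
    P.F₁ (g ∘ f) · z          ≡⟨ cong (λ k → P.F₁ k · z) gf≡g'f' ⟩
    P.F₁ (g' ∘ f') · z        ≡⟨ P-∘-· f' g' z ⟩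
    P.F₁ f' · P.F₁ g' · z     ∎

  P-cone-∘ : ∀ {X Y Z V W} {u : Z C.⇒ X} {v : Z C.⇒ Y}
             {d : W 𝒜.⇒ P.F₀ X} {d' : W 𝒜.⇒ P.F₀ Y} →
             P.F₁ u · d ≡ P.F₁ v · d' → (y : V C.⇒ Z) →
             P.F₁ (u ∘ y) · d ≡ P.F₁ (v ∘ y) · d'
  P-cone-∘ {u = u} {v} {d} {d'} cone y =
    trans (P-∘-· y u d) (trans (cong (P.F₁ y ·_) cone) (sym (P-∘-· y v d')))

  ·-L-∘ : ∀ {U V W N M} (x : N 𝒜.⇒ M) (G : L.F₀ V 𝒜.⇒ N) (p : W 𝒜.⇒ V) (u : U 𝒜.⇒ W) →
          x · G · L.F₁ (p · u) ≡ (x · G · L.F₁ p) · L.F₁ u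
  ·-L-∘ x G p u = begin
    x · G · L.F₁ (p · u)        ≡⟨ cong (λ z → x · G · z) L.F-∘ ⟩
    x · G · L.F₁ p · L.F₁ u     ≡⟨ cong (x ·_) (sym 𝒜.assoc) ⟩
    x · (G · L.F₁ p) · L.F₁ u   ≡⟨ sym 𝒜.assoc ⟩
    (x · G · L.F₁ p) · L.F₁ u   ∎

  IsRhoBisim-on-cones :
    ∀ {c₁ c₂ : Coalgebra} {s : Span C (Coalgebra.X c₁) (Coalgebra.X c₂)} → IsRhoBisim c₁ c₂ s →
    ∀ {W} {d₁ : W 𝒜.⇒ P.F₀ (Coalgebra.X c₁)} {d₂ : W 𝒜.⇒ P.F₀ (Coalgebra.X c₂)} →
    P.F₁ (Span.π₁ s) · d₁ ≡ P.F₁ (Span.π₂ s) · d₂ →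
    P.F₁ (Span.π₁ s) · complexAlg c₁ · L.F₁ d₁ ≡ P.F₁ (Span.π₂ s) · complexAlg c₂ · L.F₁ d₂
  IsRhoBisim-on-cones {c₁} {c₂} {span _ π₁ π₂} (_ , bisim) {d₁ = d₁} {d₂} cone
    with (u , p₁u≡d₁ , p₂u≡d₂) ← pullback-factor (dualPullback π₁ π₂) d₁ d₂ cone = begin
      P.F₁ π₁ · γ₁* · L.F₁ d₁            ≡⟨ cong (λ z → P.F₁ π₁ · γ₁* · L.F₁ z) (sym p₁u≡d₁) ⟩
      P.F₁ π₁ · γ₁* · L.F₁ (p₁ · u)      ≡⟨ ·-L-∘ (P.F₁ π₁) γ₁* p₁ u ⟩
      (P.F₁ π₁ · γ₁* · L.F₁ p₁) · L.F₁ u ≡⟨ cong (_· L.F₁ u) (bisim (dualPullback π₁ π₂)) ⟩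
      (P.F₁ π₂ · γ₂* · L.F₁ p₂) · L.F₁ u ≡⟨ sym (·-L-∘ (P.F₁ π₂) γ₂* p₂ u) ⟩
      P.F₁ π₂ · γ₂* · L.F₁ (p₂ · u)      ≡⟨ cong (λ z → P.F₁ π₂ · γ₂* · L.F₁ z) p₂u≡d₂ ⟩
      P.F₁ π₂ · γ₂* · L.F₁ d₂            ∎
    where
      open Pullback (dualPullback π₁ π₂) using (p₁; p₂)

      γ₁* : L.F₀ (P.F₀ (Coalgebra.X c₁)) 𝒜.⇒ P.F₀ (Coalgebra.X c₁)
      γ₁* = complexAlg c₁

      γ₂* : L.F₀ (P.F₀ (Coalgebra.X c₂)) 𝒜.⇒ P.F₀ (Coalgebra.X c₂)
      γ₂* = complexAlg c₂

module Composition {o h o' h'} (𝕊 : Setting o h o' h') (c₁ c₂ c₃ : Setting.Coalgebra 𝕊)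
  (s  : Span (Setting.C 𝕊) (Setting.Coalgebra.X c₁) (Setting.Coalgebra.X c₂))
  (s' : Span (Setting.C 𝕊) (Setting.Coalgebra.X c₂) (Setting.Coalgebra.X c₃)) where
  open Setting 𝕊
  open C using (_⇒_; _∘_; id; assoc; identityʳ)
  open 𝒜 using () renaming (_∘_ to _·_)
  open CategoryLemmas C
  open FinitelyComplete C-finitelyComplete
  open FactorisationSystem C-factorisation
  open FactorisationLemmas C C-finitelyComplete C-factorisation using (E⇒Epi)
  open SettingLemmas 𝕊
  open ≡-Reasoning
  open Span s
  open Span s' using () renaming (B to B'; π₁ to π₂′; π₂ to π₃)

  X₁ X₂ X₃ : C.Obj
  X₁ = Coalgebra.X c₁
  X₂ = Coalgebra.X c₂
  X₃ = Coalgebra.X c₃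

  pb : Pullback C π₂ π₂′
  pb = pullback π₂ π₂′
  open Pullback pb using (p₁; p₂) renaming (P to B×B')

  prod : Product C X₁ X₃
  prod = product X₁ X₃
  open Product prod using (⟨_,_⟩)

  k : B×B' ⇒ Product.X×Y prod
  k = ⟨ π₁ ∘ p₁ , π₃ ∘ p₂ ⟩

  e : B×B' ⇒ Span.B (s ⊙ s')
  e = eOf k

  q₁ : Span.B (s ⊙ s') ⇒ X₁
  q₁ = Span.π₁ (s ⊙ s')

  q₃ : Span.B (s ⊙ s') ⇒ X₃
  q₃ = Span.π₂ (s ⊙ s')

  q₁∘e : q₁ ∘ e ≡ π₁ ∘ p₁
  q₁∘e = trans (pullʳ (factorises k)) (project₁ prod)

  q₃∘e : q₃ ∘ e ≡ π₃ ∘ p₂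
  q₃∘e = trans (pullʳ (factorises k)) (project₂ prod)

  ⊙-jointlyMono : JointlyMono C (s ⊙ s')
  ⊙-jointlyMono u v q₁u≡q₁v q₃u≡q₃v = mOf-Mono k u v (product-ext prod
    (trans (sym assoc) (trans q₁u≡q₁v assoc)) (trans (sym assoc) (trans q₃u≡q₃v assoc)))

  ⊙-intro : ∀ {W} {a : W ⇒ B} {b : W ⇒ B'} → π₂ ∘ a ≡ π₂′ ∘ b →
            Σ[ w ∈ W ⇒ Span.B (s ⊙ s') ] (q₁ ∘ w ≡ π₁ ∘ a × q₃ ∘ w ≡ π₃ ∘ b)
  ⊙-intro {a = a} {b} agree =
    let (x , p₁x , p₂x) = pullback-factor pb a b agree
    in e ∘ x , trans (pullˡ q₁∘e) (pullʳ p₁x) , trans (pullˡ q₃∘e) (pullʳ p₂x)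

  ⊙-splitEpi₁ : SplitEpi C π₁ → SplitEpi C π₂′ → SplitEpi C q₁
  ⊙-splitEpi₁ (t₁ , π₁t₁) (t₂′ , π₂′t₂′) =
    let (w , q₁w , _) = ⊙-intro {a = t₁} {b = t₂′ ∘ π₂ ∘ t₁} (sym (cancelˡ π₂′t₂′))
    in w , trans q₁w π₁t₁

  ⊙-splitEpi₃ : SplitEpi C π₂ → SplitEpi C π₃ → SplitEpi C q₃
  ⊙-splitEpi₃ (t₂ , π₂t₂) (t₃ , π₃t₃) =
    let (w , _ , q₃w) = ⊙-intro {a = t₂ ∘ π₂′ ∘ t₃} {b = t₃} (cancelˡ π₂t₂)
    in w , trans q₃w π₃t₃

  module _ {W} {d₁ : W 𝒜.⇒ P.F₀ X₁} {d₃ : W 𝒜.⇒ P.F₀ X₃}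
           (cone : P.F₁ q₁ · d₁ ≡ P.F₁ q₃ · d₃) where

    related : ∀ {V} {a : V ⇒ B} {b : V ⇒ B'} → π₂ ∘ a ≡ π₂′ ∘ b →
              P.F₁ (π₁ ∘ a) · d₁ ≡ P.F₁ (π₃ ∘ b) · d₃
    related agree =
      let (w , q₁w , q₃w) = ⊙-intro agree
      in trans (cong (λ z → P.F₁ z · d₁) (sym q₁w))
               (trans (P-cone-∘ cone w) (cong (λ z → P.F₁ z · d₃) q₃w))

    middle : SplitEpi C π₂ → W 𝒜.⇒ P.F₀ X₂
    middle (t₂ , _) = P.F₁ (π₁ ∘ t₂) · d₁

    left-cone : (split₂ : SplitEpi C π₂) → SplitEpi C π₂′ →
                P.F₁ π₁ · d₁ ≡ P.F₁ π₂ · middle split₂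
    -- id and t₂ ∘ π₂ have the same π₂-image, so both are related to t₂′ ∘ π₂ in B'.
    left-cone (t₂ , π₂t₂) (t₂′ , π₂′t₂′) = begin
      P.F₁ π₁ · d₁                   ≡⟨ cong (λ z → P.F₁ z · d₁) (sym identityʳ) ⟩
      P.F₁ (π₁ ∘ id) · d₁            ≡⟨ related (trans identityʳ (sym (cancelˡ π₂′t₂′))) ⟩
      P.F₁ (π₃ ∘ t₂′ ∘ π₂) · d₃      ≡⟨ sym (related (trans (cancelˡ π₂t₂) (sym (cancelˡ π₂′t₂′)))) ⟩
      P.F₁ (π₁ ∘ t₂ ∘ π₂) · d₁       ≡⟨ cong (λ z → P.F₁ z · d₁) (sym assoc) ⟩
      P.F₁ ((π₁ ∘ t₂) ∘ π₂) · d₁     ≡⟨ P-∘-· π₂ (π₁ ∘ t₂) d₁ ⟩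
      P.F₁ π₂ · P.F₁ (π₁ ∘ t₂) · d₁  ∎

    right-cone : (split₂ : SplitEpi C π₂) → P.F₁ π₂′ · middle split₂ ≡ P.F₁ π₃ · d₃
    right-cone (t₂ , π₂t₂) = begin
      P.F₁ π₂′ · P.F₁ (π₁ ∘ t₂) · d₁  ≡⟨ sym (P-∘-· π₂′ (π₁ ∘ t₂) d₁) ⟩
      P.F₁ ((π₁ ∘ t₂) ∘ π₂′) · d₁     ≡⟨ cong (λ z → P.F₁ z · d₁) assoc ⟩
      P.F₁ (π₁ ∘ t₂ ∘ π₂′) · d₁       ≡⟨ related (trans (cancelˡ π₂t₂) (sym identityʳ)) ⟩
      P.F₁ (π₃ ∘ id) · d₃             ≡⟨ cong (λ z → P.F₁ z · d₃) identityʳ ⟩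
      P.F₁ π₃ · d₃                    ∎

    ⊙-equation-after-e : IsRhoBisim c₁ c₂ s → IsRhoBisim c₂ c₃ s' →
                         SplitEpi C π₂ → SplitEpi C π₂′ →
                         P.F₁ e · P.F₁ q₁ · complexAlg c₁ · L.F₁ d₁
                           ≡ P.F₁ e · P.F₁ q₃ · complexAlg c₃ · L.F₁ d₃
    ⊙-equation-after-e bisim bisim′ split₂ split₂′ = begin
      P.F₁ e · P.F₁ q₁ · Z₁    ≡⟨ P-square q₁∘e Z₁ ⟩
      P.F₁ p₁ · P.F₁ π₁ · Z₁   ≡⟨ cong (P.F₁ p₁ ·_) (IsRhoBisim-on-cones bisim left) ⟩
      P.F₁ p₁ · P.F₁ π₂ · Z₂   ≡⟨ P-square (Pullback.commute pb) Z₂ ⟩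
      P.F₁ p₂ · P.F₁ π₂′ · Z₂  ≡⟨ cong (P.F₁ p₂ ·_) (IsRhoBisim-on-cones bisim′ right) ⟩
      P.F₁ p₂ · P.F₁ π₃ · Z₃   ≡⟨ P-square (sym q₃∘e) Z₃ ⟩
      P.F₁ e · P.F₁ q₃ · Z₃    ∎
      where
        Z₁ : L.F₀ W 𝒜.⇒ P.F₀ X₁
        Z₁ = complexAlg c₁ · L.F₁ d₁

        Z₂ : L.F₀ W 𝒜.⇒ P.F₀ X₂
        Z₂ = complexAlg c₂ · L.F₁ (middle split₂)

        Z₃ : L.F₀ W 𝒜.⇒ P.F₀ X₃
        Z₃ = complexAlg c₃ · L.F₁ d₃

        left : P.F₁ π₁ · d₁ ≡ P.F₁ π₂ · middle split₂
        left = left-cone split₂ split₂′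

        right : P.F₁ π₂′ · middle split₂ ≡ P.F₁ π₃ · d₃
        right = right-cone split₂

  ⊙-IsRhoBisim : IsRhoBisim c₁ c₂ s → IsRhoBisim c₂ c₃ s' →
                 SplitEpi C π₂ → SplitEpi C π₂′ → IsRhoBisim c₁ c₃ (s ⊙ s')
  ⊙-IsRhoBisim bisim bisim′ split₂ split₂′ = ⊙-jointlyMono , λ dual →
    P-Epi⇒Mono (E⇒Epi (eOf-E k)) _ _
      (⊙-equation-after-e (Pullback.commute dual) bisim bisim′ split₂ split₂′)

proposition3p10 : ∀ {o h o' h' : Level} (𝕊 : Setting o h o' h') →
    (c₁ c₂ c₃ : Setting.Coalgebra 𝕊) →
    (s : Span (Setting.C 𝕊) (Setting.Coalgebra.X c₁) (Setting.Coalgebra.X c₂)) →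
    (s' : Span (Setting.C 𝕊) (Setting.Coalgebra.X c₂) (Setting.Coalgebra.X c₃)) →
    Setting.IsFullRhoBisim 𝕊 c₁ c₂ s →
    Setting.IsFullRhoBisim 𝕊 c₂ c₃ s' →
    Setting.IsFullRhoBisim 𝕊 c₁ c₃ (Setting._⊙_ 𝕊 s s')
proposition3p10 𝕊 c₁ c₂ c₃ s s' (bisim , split₁ , split₂) (bisim′ , split₂′ , split₃) =
    ⊙-IsRhoBisim bisim bisim′ split₂ split₂′
  , ⊙-splitEpi₁ split₁ split₂′
  , ⊙-splitEpi₃ split₂ split₃
  where open Composition 𝕊 c₁ c₂ c₃ s s'
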